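{- Let $k\ge 1$ be an integer and $n=2^k-1$. Then $\gamma(Q_n)=2^{n-k}=2^n/(n+1)$, and $\gamma_c(Q_n)<\dfrac{3}{n+1}\,2^n$.
   Context: The $n$-cube $Q_n$ has as vertices the $2^n$ binary strings of length $n$, two being adjacent iff they differ in exactly one coordinate. A dominating set is a vertex set $W$ such that every vertex is in $W$ or adjacent to a vertex of $W$; it is connected if it induces a connected subgraph. $\gamma(G)$ and $\gamma_c(G)$ denote the minimum sizes of a dominating set and of a connected dominating set of $G$, respectively. -}

module Defs where

open import Data.Bool using (Bool; true; false)
open import Data.Nat using (ℕ; zero; suc; _+_; _≤_)
open import Data.Vec using (Vec; []; _∷_)
open import Data.List using (List; length)
open import Data.List.Membership.Propositional using (_∈_)
open import Data.List.Relation.Unary.Any using (Any)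
open import Data.List.Relation.Unary.Unique.Propositional using (Unique)
open import Data.Product using (Σ; _×_; ∃)
open import Data.Sum using (_⊎_)
open import Relation.Binary.PropositionalEquality using (_≡_)
open import Data.Bool using (_≟_)
open import Relation.Nullary.Decidable using (does)

Vertex : ℕ → Set
Vertex n = Vec Bool n

hamming : ∀ {n} → Vertex n → Vertex n → ℕ
hamming [] [] = 0
hamming (a ∷ u) (b ∷ v) with does (a ≟ b)
... | true  = hamming u v
... | false = suc (hamming u v)

Adj : ∀ {n} → Vertex n → Vertex n → Set
Adj u v = hamming u v ≡ 1

-- vertex sets are duplicate-free lists of vertices; size = length
Dominating : ∀ {n} → List (Vertex n) → Set
Dominating {n} W = (v : Vertex n) → Any (λ w → w ≡ v ⊎ Adj w v) W

data WalkIn {n} (W : List (Vertex n)) : Vertex n → Vertex n → Set where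
  here : ∀ {u} → u ∈ W → WalkIn W u u
  step : ∀ {u v w} → u ∈ W → Adj u v → WalkIn W v w → WalkIn W u w

Connected : ∀ {n} → List (Vertex n) → Set
Connected W = ∀ {u v} → u ∈ W → v ∈ W → WalkIn W u v

IsDomSet : ∀ {n} → List (Vertex n) → Set
IsDomSet W = Unique W × Dominating W

IsConnDomSet : ∀ {n} → List (Vertex n) → Set
IsConnDomSet W = Unique W × Dominating W × Connected W

DominationNumber : ℕ → ℕ → Set
DominationNumber n m =
  (Σ (List (Vertex n)) λ W → IsDomSet W × length W ≡ m)
  × ((W : List (Vertex n)) → IsDomSet W → m ≤ length W)

ConnDominationNumber : ℕ → ℕ → Set
ConnDominationNumber n m =
  (Σ (List (Vertex n)) λ W → IsConnDomSet W × length W ≡ m)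
  × ((W : List (Vertex n)) → IsConnDomSet W → m ≤ length W)

module Submission where

-- Lower bound (sphere packing): a closed neighbourhood in Q_n has n + 1
-- vertices, so every dominating set has at least 2^n / (n + 1) elements.
--
-- Upper bound: write vertices of Q_{2n+1} as triples (a, b, c) with a, b in
-- Q_n and c a check bit.  If every vertex of Q_n is within distance 1 of S,
-- the same holds in Q_{2n+1} for the doubled set of codewords
-- (a, a ⊕ v, parity a) with a in Q_n and v in S.  Doubling the origin of Q_1
-- j times gives the Hamming code of length n = 2^(j+1) - 1, which meets the
-- sphere-packing bound and therefore realises γ(Q_n).
--
-- Connected domination: adding the two vertices (a, parent a, ·) for each
-- a ≠ 0, where parent clears the first 1-bit, joins every block of the
-- doubled set to the block of parent a.  Started from a connected set
-- containing 0 this stays connected, with fewer than 3 · 2^n / (n + 1)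
-- vertices.  Since connected domination is decidable on the finite Q_n,
-- a minimum connected dominating set exists, and it is no larger.

open import Defs
open import Data.Nat using (ℕ; zero; suc; _+_; _*_; _∸_; _^_; _≤_; _<_; z≤n; s≤s; >-nonZero)
open import Data.Nat.Properties
open import Data.Nat.Induction using (<-wellFounded)
open import Data.Bool using (Bool; true; false; not; _xor_)
import Data.Bool as Bool
import Data.Bool.Properties as BoolP
open import Data.Vec using ([]; _∷_; _++_; splitAt)
import Data.Vec.Properties as VecP
open import Data.List using (List; length; map; filter; concatMap; deduplicate)
import Data.List as List
import Data.List.Properties as ListP
open import Data.List.Membership.Propositional using (_∈_; lose)
open import Data.List.Membership.Propositional.Properties
open import Data.List.Relation.Binary.Subset.Propositional using (_⊆_)
open import Data.List.Relation.Unary.Any as Any using (Any; here; there)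
open import Data.List.Relation.Unary.All as All using (all?)
open import Data.List.Relation.Unary.AllPairs as AllPairs using (allPairs?)
open import Data.List.Relation.Unary.Unique.Propositional using (Unique)
import Data.List.Relation.Unary.Unique.Propositional.Properties as UniqueP
import Data.List.Relation.Unary.Unique.DecPropositional.Properties as DecUniqueP
open import Data.Product using (Σ; _×_; _,_; proj₁; proj₂)
open import Data.Sum using (_⊎_; inj₁; inj₂)
open import Data.Empty using (⊥; ⊥-elim)
open import Induction.WellFounded using (Acc; acc)
open import Relation.Nullary using (¬_; Dec; yes; no; ¬?)
open import Relation.Nullary.Decidable using (map′; _×-dec_; _⊎-dec_)
open import Relation.Binary.Definitions using (DecidableEquality)
open import Relation.Binary.PropositionalEquality
open import Data.Nat.Solver using (module +-*-Solver)
open +-*-Solver using (solve; _:+_; _:*_; _:=_; con)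

-- Q_n as the group (ℤ/2)^n

zeros : ∀ {n} → Vertex n
zeros {zero} = []
zeros {suc n} = false ∷ zeros

infixl 6 _⊕_
_⊕_ : ∀ {n} → Vertex n → Vertex n → Vertex n
[] ⊕ [] = []
(a ∷ x) ⊕ (b ∷ y) = (a xor b) ∷ (x ⊕ y)

⊕-comm : ∀ {n} (x y : Vertex n) → x ⊕ y ≡ y ⊕ x
⊕-comm [] [] = refl
⊕-comm (a ∷ x) (b ∷ y) = cong₂ _∷_ (BoolP.xor-comm a b) (⊕-comm x y)

⊕-assoc : ∀ {n} (x y z : Vertex n) → x ⊕ y ⊕ z ≡ x ⊕ (y ⊕ z)
⊕-assoc [] [] [] = refl
⊕-assoc (a ∷ x) (b ∷ y) (c ∷ z) = cong₂ _∷_ (BoolP.xor-assoc a b c) (⊕-assoc x y z)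

⊕-identityʳ : ∀ {n} (x : Vertex n) → x ⊕ zeros ≡ x
⊕-identityʳ [] = refl
⊕-identityʳ (a ∷ x) = cong₂ _∷_ (BoolP.xor-identityʳ a) (⊕-identityʳ x)

⊕-self : ∀ {n} (x : Vertex n) → x ⊕ x ≡ zeros
⊕-self [] = refl
⊕-self (a ∷ x) = cong₂ _∷_ (BoolP.xor-same a) (⊕-self x)

⊕-cancelʳ : ∀ {n} (x y : Vertex n) → x ⊕ y ⊕ y ≡ x
⊕-cancelʳ x y = begin
  x ⊕ y ⊕ y    ≡⟨ ⊕-assoc x y y ⟩
  x ⊕ (y ⊕ y)  ≡⟨ cong (x ⊕_) (⊕-self y) ⟩
  x ⊕ zeros    ≡⟨ ⊕-identityʳ x ⟩
  x            ∎
  where open ≡-Reasoning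

⊕-cancelˡ : ∀ {n} (x y : Vertex n) → x ⊕ (x ⊕ y) ≡ y
⊕-cancelˡ x y = begin
  x ⊕ (x ⊕ y)  ≡⟨ ⊕-comm x (x ⊕ y) ⟩
  x ⊕ y ⊕ x    ≡⟨ cong (_⊕ x) (⊕-comm x y) ⟩
  y ⊕ x ⊕ x    ≡⟨ ⊕-cancelʳ y x ⟩
  y            ∎
  where open ≡-Reasoning

parity : ∀ {n} → Vertex n → Bool
parity [] = false
parity (a ∷ x) = a xor parity x

hamming-self : ∀ {n} (x : Vertex n) → hamming x x ≡ 0
hamming-self [] = refl
hamming-self (true ∷ x) = hamming-self x
hamming-self (false ∷ x) = hamming-self x

hamming-zero : ∀ {n} (x y : Vertex n) → hamming x y ≡ 0 → x ≡ y
hamming-zero [] [] _ = refl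
hamming-zero (true ∷ x) (true ∷ y) d = cong (true ∷_) (hamming-zero x y d)
hamming-zero (false ∷ x) (false ∷ y) d = cong (false ∷_) (hamming-zero x y d)

hamming-sym : ∀ {n} (x y : Vertex n) → hamming x y ≡ hamming y x
hamming-sym [] [] = refl
hamming-sym (true ∷ x) (true ∷ y) = hamming-sym x y
hamming-sym (true ∷ x) (false ∷ y) = cong suc (hamming-sym x y)
hamming-sym (false ∷ x) (true ∷ y) = cong suc (hamming-sym x y)
hamming-sym (false ∷ x) (false ∷ y) = hamming-sym x y

hamming-shift : ∀ {n} (x y z : Vertex n) → hamming (x ⊕ y) z ≡ hamming y (x ⊕ z)
hamming-shift [] [] [] = refl
hamming-shift (true ∷ x) (true ∷ y) (true ∷ z) = cong suc (hamming-shift x y z)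
hamming-shift (true ∷ x) (true ∷ y) (false ∷ z) = hamming-shift x y z
hamming-shift (true ∷ x) (false ∷ y) (true ∷ z) = hamming-shift x y z
hamming-shift (true ∷ x) (false ∷ y) (false ∷ z) = cong suc (hamming-shift x y z)
hamming-shift (false ∷ x) (true ∷ y) (true ∷ z) = hamming-shift x y z
hamming-shift (false ∷ x) (true ∷ y) (false ∷ z) = cong suc (hamming-shift x y z)
hamming-shift (false ∷ x) (false ∷ y) (true ∷ z) = cong suc (hamming-shift x y z)
hamming-shift (false ∷ x) (false ∷ y) (false ∷ z) = hamming-shift x y z

hamming-translate : ∀ {n} (x y z : Vertex n) → hamming (x ⊕ y) (x ⊕ z) ≡ hamming y z
hamming-translate x y z = trans (hamming-shift x y (x ⊕ z)) (cong (hamming y) (⊕-cancelˡ x z))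

hamming-++ : ∀ {m n} (x y : Vertex m) (x′ y′ : Vertex n) →
  hamming (x ++ x′) (y ++ y′) ≡ hamming x y + hamming x′ y′
hamming-++ [] [] x′ y′ = refl
hamming-++ (true ∷ x) (true ∷ y) x′ y′ = hamming-++ x y x′ y′
hamming-++ (true ∷ x) (false ∷ y) x′ y′ = cong suc (hamming-++ x y x′ y′)
hamming-++ (false ∷ x) (true ∷ y) x′ y′ = cong suc (hamming-++ x y x′ y′)
hamming-++ (false ∷ x) (false ∷ y) x′ y′ = hamming-++ x y x′ y′

bit-distance≤1 : ∀ (b c : Bool) → hamming (b ∷ []) (c ∷ []) ≤ 1
bit-distance≤1 true true = z≤n
bit-distance≤1 true false = s≤s z≤n
bit-distance≤1 false true = s≤s z≤n
bit-distance≤1 false false = z≤n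

bit-flip : ∀ (b : Bool) → hamming (not b ∷ []) (b ∷ []) ≡ 1
bit-flip true = refl
bit-flip false = refl

≤1-cases : ∀ {d} → d ≤ 1 → d ≡ 0 ⊎ d ≡ 1
≤1-cases z≤n = inj₁ refl
≤1-cases (s≤s z≤n) = inj₂ refl

adj-sym : ∀ {n} (u v : Vertex n) → Adj u v → Adj v u
adj-sym u v uv = trans (hamming-sym v u) uv

parity-flip : ∀ {n} (x y : Vertex n) → Adj x y → parity x ≡ not (parity y)
parity-flip [] [] ()
parity-flip (true ∷ x) (true ∷ y) xy = cong not (parity-flip x y xy)
parity-flip (false ∷ x) (false ∷ y) xy = parity-flip x y xy
parity-flip (true ∷ x) (false ∷ y) xy
  rewrite hamming-zero x y (suc-injective xy) = refl
parity-flip (false ∷ x) (true ∷ y) xy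
  rewrite hamming-zero x y (suc-injective xy) = sym (BoolP.not-involutive _)

-- Q_{2n+1} as triples of two halves and a check bit

block : ∀ {n} → Vertex n → Vertex n → Bool → Vertex (n + (n + 1))
block a b c = a ++ (b ++ (c ∷ []))

blocks : ∀ {n} (x : Vertex (n + (n + 1))) →
  Σ (Vertex n) λ a → Σ (Vertex n) λ b → Σ Bool λ c → x ≡ block a b c
blocks {n} x with splitAt n x
... | a , y , refl with splitAt n y
...   | b , c ∷ [] , refl = a , b , c , refl

block-distance : ∀ {n} (a b : Vertex n) (c : Bool) (a′ b′ : Vertex n) (c′ : Bool) {i j k : ℕ} →
  hamming a a′ ≡ i → hamming b b′ ≡ j → hamming (c ∷ []) (c′ ∷ []) ≡ k →
  hamming (block a b c) (block a′ b′ c′) ≡ i + (j + k)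
block-distance a b c a′ b′ c′ refl refl refl =
  trans (hamming-++ a a′ _ _) (cong (hamming a a′ +_) (hamming-++ b b′ _ _))

cube : ∀ n → List (Vertex n)
cube zero = [] List.∷ List.[]
cube (suc n) = map (false ∷_) (cube n) List.++ map (true ∷_) (cube n)

cube-complete : ∀ {n} (v : Vertex n) → v ∈ cube n
cube-complete [] = here refl
cube-complete (false ∷ v) = ∈-++⁺ˡ (∈-map⁺ (false ∷_) (cube-complete v))
cube-complete {suc n} (true ∷ v) =
  ∈-++⁺ʳ (map (false ∷_) (cube n)) (∈-map⁺ (true ∷_) (cube-complete v))

cube-unique : ∀ n → Unique (cube n)
cube-unique zero = All.[] AllPairs.∷ AllPairs.[]
cube-unique (suc n) =
  UniqueP.++⁺ (UniqueP.map⁺ VecP.∷-injectiveʳ (cube-unique n))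
              (UniqueP.map⁺ VecP.∷-injectiveʳ (cube-unique n)) disjoint
  where
  disjoint : ∀ {v} → v ∈ map (false ∷_) (cube n) × v ∈ map (true ∷_) (cube n) → ⊥
  disjoint (p , q) with ∈-map⁻ (false ∷_) p | ∈-map⁻ (true ∷_) q
  ... | _ , _ , refl | _ , _ , ()

cube-length : ∀ n → length (cube n) ≡ 2 ^ n
cube-length zero = refl
cube-length (suc n) = begin
    length (map (false ∷_) (cube n) List.++ map (true ∷_) (cube n))
  ≡⟨ ListP.length-++ (map (false ∷_) (cube n)) ⟩
    length (map (false ∷_) (cube n)) + length (map (true ∷_) (cube n))
  ≡⟨ cong₂ _+_ (ListP.length-map (false ∷_) (cube n)) (ListP.length-map (true ∷_) (cube n)) ⟩
    length (cube n) + length (cube n)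
  ≡⟨ cong (λ t → t + t) (cube-length n) ⟩
    2 ^ n + 2 ^ n
  ≡⟨ cong (2 ^ n +_) (+-identityʳ (2 ^ n)) ⟨
    2 ^ suc n ∎
  where open ≡-Reasoning

_≟V_ : ∀ {n} → DecidableEquality (Vertex n)
_≟V_ = VecP.≡-dec Bool._≟_

nonzero : ∀ n → List (Vertex n)
nonzero n = filter (λ x → ¬? (x ≟V zeros)) (cube n)

nonzero-complete : ∀ {n} (a : Vertex n) → ¬ a ≡ zeros → a ∈ nonzero n
nonzero-complete a a≢0 = ∈-filter⁺ (λ x → ¬? (x ≟V zeros)) (cube-complete a) a≢0

nonzero-sound : ∀ {n} {a : Vertex n} → a ∈ nonzero n → ¬ a ≡ zeros
nonzero-sound {n} p = proj₂ (∈-filter⁻ (λ x → ¬? (x ≟V zeros)) {xs = cube n} p)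

nonzero-length : ∀ n → length (nonzero n) < 2 ^ n
nonzero-length n = subst (length (nonzero n) <_) (cube-length n)
  (ListP.filter-notAll (λ x → ¬? (x ≟V zeros)) (cube n)
    (Any.map (λ 0≡x x≢0 → x≢0 (sym 0≡x)) (cube-complete zeros)))

length-concatMap : ∀ {A B : Set} (f : A → List B) (c : ℕ) →
  (∀ x → length (f x) ≡ c) → ∀ xs → length (concatMap f xs) ≡ length xs * c
length-concatMap f c fc List.[] = refl
length-concatMap f c fc (x List.∷ xs) =
  trans (ListP.length-++ (f x)) (cong₂ _+_ (fc x) (length-concatMap f c fc xs))

unique-⊆-length : ∀ {A : Set} → DecidableEquality A →
  ∀ (xs ys : List A) → Unique xs → xs ⊆ ys → length xs ≤ length ys
unique-⊆-length _≟_ List.[] ys _ _ = z≤n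
unique-⊆-length _≟_ (x List.∷ xs) ys (x∉xs AllPairs.∷ xs!) xs⊆ys =
  ≤-trans (s≤s (unique-⊆-length _≟_ xs ys′ xs! xs⊆ys′)) shorter
  where
  ys′ = filter (λ y → ¬? (x ≟ y)) ys
  xs⊆ys′ : xs ⊆ ys′
  xs⊆ys′ p = ∈-filter⁺ (λ y → ¬? (x ≟ y)) (xs⊆ys (there p)) (All.lookup x∉xs p)
  shorter : suc (length ys′) ≤ length ys
  shorter = ListP.filter-notAll (λ y → ¬? (x ≟ y)) ys
              (Any.map (λ x≡y x≢y → x≢y x≡y) (xs⊆ys (here refl)))

-- Sphere packing: |W| ≥ 2^n / (n + 1) for every dominating set W

neighbours : ∀ {n} → Vertex n → List (Vertex n)
neighbours [] = List.[]
neighbours (a ∷ u) = (not a ∷ u) List.∷ map (a ∷_) (neighbours u)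

neighbours-length : ∀ {n} (u : Vertex n) → length (neighbours u) ≡ n
neighbours-length [] = refl
neighbours-length (a ∷ u) =
  cong suc (trans (ListP.length-map (a ∷_) (neighbours u)) (neighbours-length u))

adj⇒neighbour : ∀ {n} (w v : Vertex n) → Adj w v → v ∈ neighbours w
adj⇒neighbour [] [] ()
adj⇒neighbour (true ∷ w) (true ∷ v) wv = there (∈-map⁺ (true ∷_) (adj⇒neighbour w v wv))
adj⇒neighbour (false ∷ w) (false ∷ v) wv = there (∈-map⁺ (false ∷_) (adj⇒neighbour w v wv))
adj⇒neighbour (true ∷ w) (false ∷ v) wv rewrite hamming-zero w v (suc-injective wv) = here refl
adj⇒neighbour (false ∷ w) (true ∷ v) wv rewrite hamming-zero w v (suc-injective wv) = here refl

ball : ∀ {n} → Vertex n → List (Vertex n)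
ball w = w List.∷ neighbours w

-- The balls around W cover all 2^n vertices and have n + 1 elements each.
sphere-packing : ∀ {n} (W : List (Vertex n)) → Dominating W → 2 ^ n ≤ suc n * length W
sphere-packing {n} W dom = begin
    2 ^ n
  ≡⟨ cube-length n ⟨
    length (cube n)
  ≤⟨ unique-⊆-length _≟V_ (cube n) (concatMap ball W) (cube-unique n) (λ {v} _ → covered v) ⟩
    length (concatMap ball W)
  ≡⟨ length-concatMap ball (suc n) (λ w → cong suc (neighbours-length w)) W ⟩
    length W * suc n
  ≡⟨ *-comm (length W) (suc n) ⟩
    suc n * length W ∎
  where
  open ≤-Reasoning
  inBall : ∀ {w v} → w ≡ v ⊎ Adj w v → v ∈ ball w
  inBall (inj₁ refl) = here refl
  inBall (inj₂ wv) = there (adj⇒neighbour _ _ wv)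
  covered : ∀ v → v ∈ concatMap ball W
  covered v = ∈-concatMap⁺ ball (Any.map inBall (dom v))

Covers : ∀ {n} → List (Vertex n) → Set
Covers {n} S = (w : Vertex n) → Σ (Vertex n) λ v → v ∈ S × hamming v w ≤ 1

covers⇒dominating : ∀ {n} {S : List (Vertex n)} → Covers S → Dominating S
covers⇒dominating cov w with cov w
... | v , v∈S , d with ≤1-cases d
...   | inj₁ d≡0 = lose v∈S (inj₁ (hamming-zero v w d≡0))
...   | inj₂ d≡1 = lose v∈S (inj₂ d≡1)

covers-⊆ : ∀ {n} {S T : List (Vertex n)} → S ⊆ T → Covers S → Covers T
covers-⊆ S⊆T cov w with cov w
... | v , v∈S , d = v , S⊆T v∈S , d

-- The doubling construction Q_n ⇝ Q_{2n+1}

codeword : ∀ {n} → Vertex n → Vertex n → Vertex (n + (n + 1))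
codeword a v = block a (a ⊕ v) (parity a)

double : ∀ {n} → List (Vertex n) → List (Vertex (n + (n + 1)))
double {n} S = concatMap (λ a → map (codeword a) S) (cube n)

codeword∈double : ∀ {n} (S : List (Vertex n)) a {v} → v ∈ S → codeword a v ∈ double S
codeword∈double {n} S a v∈S =
  ∈-concatMap⁺ (λ a → map (codeword a) S) (lose (cube-complete a) (∈-map⁺ (codeword a) v∈S))

double-length : ∀ {n} (S : List (Vertex n)) → length (double S) ≡ 2 ^ n * length S
double-length {n} S =
  trans (length-concatMap _ (length S) (λ a → ListP.length-map (codeword a) S) (cube n))
        (cong (_* length S) (cube-length n))

-- If the check bit c
-- is wrong, the error is moved into the first half: a′ = b ⊕ v.
nearby-codeword : ∀ {n} (a b : Vertex n) (c : Bool) (v : Vertex n) →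
  hamming v (a ⊕ b) ≤ 1 → Σ (Vertex n) λ a′ → hamming (codeword a′ v) (block a b c) ≤ 1
nearby-codeword a b c v d with ≤1-cases d
... | inj₁ d≡0 = a , subst (_≤ 1) (sym exact) (bit-distance≤1 (parity a) c)
  where
  exact : hamming (codeword a v) (block a b c) ≡ 0 + (0 + hamming (parity a ∷ []) (c ∷ []))
  exact = block-distance a (a ⊕ v) (parity a) a b c
            (hamming-self a) (trans (hamming-shift a v b) d≡0) refl
... | inj₂ d≡1 with parity a Bool.≟ c
...   | yes refl = a , ≤-reflexive (block-distance a (a ⊕ v) c a b c
                     (hamming-self a) (trans (hamming-shift a v b) d≡1) (hamming-self (c ∷ [])))
...   | no pa≢c = b ⊕ v , ≤-reflexive (block-distance (b ⊕ v) (b ⊕ v ⊕ v) (parity (b ⊕ v)) a b c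
                                         first middle check)
  where
  first : hamming (b ⊕ v) a ≡ 1
  first = trans (hamming-shift b v a) (trans (cong (hamming v) (⊕-comm b a)) d≡1)
  middle : hamming (b ⊕ v ⊕ v) b ≡ 0
  middle = trans (cong (λ x → hamming x b) (⊕-cancelʳ b v)) (hamming-self b)
  check-bit : parity (b ⊕ v) ≡ c
  check-bit = trans (parity-flip (b ⊕ v) a first) (sym (BoolP.¬-not (λ c≡pa → pa≢c (sym c≡pa))))
  check : hamming (parity (b ⊕ v) ∷ []) (c ∷ []) ≡ 0
  check = trans (cong (λ x → hamming (x ∷ []) (c ∷ [])) check-bit) (hamming-self (c ∷ []))

double-covers : ∀ {n} (S : List (Vertex n)) → Covers S → Covers (double S)
double-covers {n} S cov x with blocks {n} x
... | a , b , c , refl with cov (a ⊕ b)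
...   | v , v∈S , d with nearby-codeword a b c v d
...     | a′ , d′ = codeword a′ v , codeword∈double S a′ v∈S , d′

walk-start : ∀ {n} {W : List (Vertex n)} {u v} → WalkIn W u v → u ∈ W
walk-start (here u∈W) = u∈W
walk-start (step u∈W _ _) = u∈W

module _ {n : ℕ} {W : List (Vertex n)} where
  infixr 5 _▹_
  _▹_ : ∀ {u v w} → WalkIn W u v → WalkIn W v w → WalkIn W u w
  here _ ▹ q = q
  step u∈W uv p ▹ q = step u∈W uv (p ▹ q)

  walk-reverse : ∀ {u v} → WalkIn W u v → WalkIn W v u
  walk-reverse (here u∈W) = here u∈W
  walk-reverse (step {u} {v} u∈W uv p) =
    walk-reverse p ▹ step (walk-start p) (adj-sym u v uv) (here u∈W)

  connected-via-root : ∀ {r} → (∀ {u} → u ∈ W → WalkIn W u r) → Connected W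
  connected-via-root to-root u∈W v∈W = to-root u∈W ▹ walk-reverse (to-root v∈W)

walk-⊆ : ∀ {n} {W W′ : List (Vertex n)} → W ⊆ W′ → ∀ {u v} → WalkIn W u v → WalkIn W′ u v
walk-⊆ W⊆W′ (here u∈W) = here (W⊆W′ u∈W)
walk-⊆ W⊆W′ (step u∈W uv p) = step (W⊆W′ u∈W) uv (walk-⊆ W⊆W′ p)

walk-map : ∀ {m n} {D : List (Vertex m)} {W : List (Vertex n)} (f : Vertex m → Vertex n) →
  (∀ {x} → x ∈ D → f x ∈ W) → (∀ x y → Adj x y → Adj (f x) (f y)) →
  ∀ {u v} → WalkIn D u v → WalkIn W (f u) (f v)
walk-map f f∈ f-adj (here u∈D) = here (f∈ u∈D)
walk-map f f∈ f-adj (step {u} {v} u∈D uv p) = step (f∈ u∈D) (f-adj u v uv) (walk-map f f∈ f-adj p)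

-- A spanning tree of Q_n rooted at the origin

-- parent clears the first 1-bit; the edges a — parent a form the tree.
parent : ∀ {n} → Vertex n → Vertex n
parent [] = []
parent (true ∷ u) = false ∷ u
parent (false ∷ u) = false ∷ parent u

weight : ∀ {n} → Vertex n → ℕ
weight [] = 0
weight (true ∷ u) = suc (weight u)
weight (false ∷ u) = weight u

parent-adj : ∀ {n} (a : Vertex n) → ¬ a ≡ zeros → Adj a (parent a)
parent-adj [] a≢0 = ⊥-elim (a≢0 refl)
parent-adj (true ∷ u) _ = cong suc (hamming-self u)
parent-adj (false ∷ u) a≢0 = parent-adj u (λ u≡0 → a≢0 (cong (false ∷_) u≡0))

parent-weight : ∀ {n} (a : Vertex n) → ¬ a ≡ zeros → suc (weight (parent a)) ≡ weight a
parent-weight [] a≢0 = ⊥-elim (a≢0 refl)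
parent-weight (true ∷ u) _ = refl
parent-weight (false ∷ u) a≢0 = parent-weight u (λ u≡0 → a≢0 (cong (false ∷_) u≡0))

-- The codeword with second part 0 in block a, and the two vertices
-- joining it to the hub of block (parent a):
--   hub a — bridge₁ a — bridge₂ a — hub (parent a).
hub : ∀ {n} → Vertex n → Vertex (n + (n + 1))
hub a = codeword a zeros

bridge₁ bridge₂ : ∀ {n} → Vertex n → Vertex (n + (n + 1))
bridge₁ a = block a (parent a) (parity a)
bridge₂ a = block a (parent a) (parity (parent a))

bridges : ∀ n → List (Vertex (n + (n + 1)))
bridges n = map bridge₁ (nonzero n) List.++ map bridge₂ (nonzero n)

connected-double : ∀ {n} → List (Vertex n) → List (Vertex (n + (n + 1)))
connected-double {n} D = double D List.++ bridges n

codeword-adj : ∀ {n} (a : Vertex n) x y → Adj x y → Adj (codeword a x) (codeword a y)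
codeword-adj a x y xy = block-distance a (a ⊕ x) (parity a) a (a ⊕ y) (parity a)
  (hamming-self a) (trans (hamming-translate a x y) xy) (hamming-self (parity a ∷ []))

hub~bridge₁ : ∀ {n} (a : Vertex n) → ¬ a ≡ zeros → Adj (hub a) (bridge₁ a)
hub~bridge₁ a a≢0 = block-distance a (a ⊕ zeros) (parity a) a (parent a) (parity a)
  (hamming-self a)
  (trans (cong (λ x → hamming x (parent a)) (⊕-identityʳ a)) (parent-adj a a≢0))
  (hamming-self (parity a ∷ []))

bridge₁~bridge₂ : ∀ {n} (a : Vertex n) → ¬ a ≡ zeros → Adj (bridge₁ a) (bridge₂ a)
bridge₁~bridge₂ a a≢0 =
  block-distance a (parent a) (parity a) a (parent a) (parity (parent a))
  (hamming-self a) (hamming-self (parent a)) check-flip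
  where
  check-flip : hamming (parity a ∷ []) (parity (parent a) ∷ []) ≡ 1
  check-flip = trans (cong (λ p → hamming (p ∷ []) (parity (parent a) ∷ []))
                           (parity-flip a (parent a) (parent-adj a a≢0)))
                     (bit-flip (parity (parent a)))

bridge₂~hub : ∀ {n} (a : Vertex n) → ¬ a ≡ zeros → Adj (bridge₂ a) (hub (parent a))
bridge₂~hub a a≢0 =
  block-distance a (parent a) (parity (parent a))
                 (parent a) (parent a ⊕ zeros) (parity (parent a))
    (parent-adj a a≢0)
    (trans (cong (hamming (parent a)) (⊕-identityʳ (parent a))) (hamming-self (parent a)))
    (hamming-self (parity (parent a) ∷ []))

hub-zeros : ∀ {n} → hub (zeros {n}) ≡ zeros
hub-zeros {n} = begin
    block (zeros {n}) (zeros ⊕ zeros) (parity (zeros {n}))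
  ≡⟨ cong₂ (block (zeros {n})) (⊕-self (zeros {n})) (parity-zeros n) ⟩
    zeros {n} ++ (zeros {n} ++ zeros {1})
  ≡⟨ cong (zeros {n} ++_) (zeros-++ n 1) ⟨
    zeros {n} ++ zeros {n + 1}
  ≡⟨ zeros-++ n (n + 1) ⟨
    zeros ∎
  where
  open ≡-Reasoning
  parity-zeros : ∀ m → parity (zeros {m}) ≡ false
  parity-zeros zero = refl
  parity-zeros (suc m) = parity-zeros m
  zeros-++ : ∀ m k → zeros {m + k} ≡ zeros {m} ++ zeros {k}
  zeros-++ zero k = refl
  zeros-++ (suc m) k = cong (false ∷_) (zeros-++ m k)

-- Connected doubling keeps the origin and connectivity: every codeword
-- walks inside its block to the hub, and hubs walk down the spanning tree.
module ConnectedDouble {n : ℕ} (D : List (Vertex n)) (0∈D : zeros ∈ D)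
                       (D-connected : Connected D) where

  W : List (Vertex (n + (n + 1)))
  W = connected-double D

  codeword∈ : ∀ a {v} → v ∈ D → codeword a v ∈ W
  codeword∈ a v∈D = ∈-++⁺ˡ (codeword∈double D a v∈D)

  hub∈ : ∀ a → hub a ∈ W
  hub∈ a = codeword∈ a 0∈D

  bridge₁∈ : ∀ {a} → a ∈ nonzero n → bridge₁ a ∈ W
  bridge₁∈ a∈ = ∈-++⁺ʳ (double D) (∈-++⁺ˡ (∈-map⁺ bridge₁ a∈))

  bridge₂∈ : ∀ {a} → a ∈ nonzero n → bridge₂ a ∈ W
  bridge₂∈ a∈ = ∈-++⁺ʳ (double D) (∈-++⁺ʳ (map bridge₁ (nonzero n)) (∈-map⁺ bridge₂ a∈))

  root : Vertex (n + (n + 1))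
  root = hub (zeros {n})

  hub-to-root : ∀ w (a : Vertex n) → weight a ≡ w → WalkIn W (hub a) root
  hub-to-root w a wa with a ≟V zeros
  ... | yes refl = here (hub∈ zeros)
  hub-to-root zero a wa | no a≢0 = ⊥-elim (1+n≢0 (trans (parent-weight a a≢0) wa))
  hub-to-root (suc w) a wa | no a≢0 =
    step (hub∈ a) (hub~bridge₁ a a≢0)
      (step (bridge₁∈ a∈) (bridge₁~bridge₂ a a≢0)
        (step (bridge₂∈ a∈) (bridge₂~hub a a≢0)
          (hub-to-root w (parent a) (suc-injective (trans (parent-weight a a≢0) wa)))))
    where
    a∈ = nonzero-complete a a≢0

  to-root : ∀ {u} → u ∈ W → WalkIn W u root
  to-root u∈W with ∈-++⁻ (double D) u∈W
  ... | inj₁ u∈double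
    with Any.satisfied (∈-concatMap⁻ (λ a → map (codeword a) D) {xs = cube n} u∈double)
  ...   | a , u∈block with ∈-map⁻ (codeword a) u∈block
  ...     | v , v∈D , refl =
    walk-map (codeword a) (codeword∈ a) (codeword-adj a) (D-connected v∈D 0∈D)
      ▹ hub-to-root (weight a) a refl
  to-root u∈W | inj₂ u∈bridges with ∈-++⁻ (map bridge₁ (nonzero n)) u∈bridges
  ... | inj₁ u∈b₁ with ∈-map⁻ bridge₁ u∈b₁
  ...   | a , a∈ , refl =
    step (bridge₁∈ a∈) (adj-sym (hub a) (bridge₁ a) (hub~bridge₁ a (nonzero-sound a∈)))
      (hub-to-root (weight a) a refl)
  to-root u∈W | inj₂ u∈bridges | inj₂ u∈b₂ with ∈-map⁻ bridge₂ u∈b₂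
  ...   | a , a∈ , refl =
    step (bridge₂∈ a∈) (bridge₂~hub a (nonzero-sound a∈))
      (hub-to-root (weight (parent a)) (parent a) refl)

  connected : Connected W
  connected = connected-via-root to-root

  contains-zero : zeros ∈ W
  contains-zero = subst (_∈ W) (hub-zeros {n}) (hub∈ zeros)

-- Each nonzero a adds two bridge vertices, fewer than 2 · 2^n in total.
connected-double-length : ∀ {n} (D : List (Vertex n)) →
  length (connected-double D) + 2 ≤ 2 ^ n * (length D + 2)
connected-double-length {n} D = begin
    length (double D List.++ bridges n) + 2
  ≡⟨ cong (_+ 2) (ListP.length-++ (double D)) ⟩
    length (double D) + length (bridges n) + 2
  ≡⟨ cong₂ (λ x y → x + y + 2) (double-length D) bridges-length ⟩
    2 ^ n * length D + (z + z) + 2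
  ≡⟨ solve 3 (λ p d z → p :* d :+ (z :+ z) :+ con 2 := p :* d :+ con 2 :* (con 1 :+ z))
           refl (2 ^ n) (length D) z ⟩
    2 ^ n * length D + 2 * suc z
  ≤⟨ +-monoʳ-≤ (2 ^ n * length D) (*-monoʳ-≤ 2 (nonzero-length n)) ⟩
    2 ^ n * length D + 2 * 2 ^ n
  ≡⟨ solve 2 (λ p d → p :* d :+ con 2 :* p := p :* (d :+ con 2)) refl (2 ^ n) (length D) ⟩
    2 ^ n * (length D + 2) ∎
  where
  open ≤-Reasoning
  z = length (nonzero n)
  bridges-length : length (bridges n) ≡ z + z
  bridges-length = trans (ListP.length-++ (map bridge₁ (nonzero n)))
    (cong₂ _+_ (ListP.length-map bridge₁ (nonzero n)) (ListP.length-map bridge₂ (nonzero n)))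

-- Decidability of connected domination

adjacent? : ∀ {n} (u v : Vertex n) → Dec (Adj u v)
adjacent? u v = hamming u v ≟ 1

module _ {n : ℕ} where
  _∖_ : List (Vertex n) → Vertex n → List (Vertex n)
  W ∖ u = filter (λ x → ¬? (x ≟V u)) W

  ∖-⊆ : ∀ {W u} → W ∖ u ⊆ W
  ∖-⊆ {W} {u} x∈ = proj₁ (∈-filter⁻ (λ x → ¬? (x ≟V u)) {xs = W} x∈)

  ∈-∖ : ∀ {W u x} → x ∈ W → ¬ x ≡ u → x ∈ W ∖ u
  ∈-∖ {u = u} x∈W x≢u = ∈-filter⁺ (λ x → ¬? (x ≟V u)) x∈W x≢u

  ∖-shorter : ∀ {u} W → u ∈ W → length (W ∖ u) < length W
  ∖-shorter {u} W u∈W = ListP.filter-notAll (λ x → ¬? (x ≟V u)) W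
    (Any.map (λ u≡x x≢u → x≢u (sym u≡x)) u∈W)

  last-exit : ∀ {W u a v} → WalkIn W a v → ¬ v ≡ u →
    (¬ a ≡ u × WalkIn (W ∖ u) a v) ⊎ Σ (Vertex n) (λ x → Adj u x × WalkIn (W ∖ u) x v)
  last-exit (here v∈W) v≢u = inj₁ (v≢u , here (∈-∖ v∈W v≢u))
  last-exit {u = u} (step {a} {b} a∈W ab p) v≢u with last-exit p v≢u
  ... | inj₂ exit = inj₂ exit
  ... | inj₁ (_ , p′) with a ≟V u
  ...   | yes refl = inj₂ (b , ab , p′)
  ...   | no a≢u = inj₁ (a≢u , step (∈-∖ a∈W a≢u) ab p′)

  -- Reachability inside W, by recursion on the size of W: a walk from
  -- u ≠ v steps to a neighbour and may then avoid u.
  walk? : ∀ W → Acc _<_ (length W) → ∀ u v → Dec (WalkIn W u v)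
  walk? W (acc smaller) u v with Any.any? (u ≟V_) W
  ... | no u∉W = no (λ p → u∉W (walk-start p))
  ... | yes u∈W with u ≟V v
  ...   | yes refl = yes (here u∈W)
  ...   | no u≢v with Any.any? (λ x → adjacent? u x ×-dec
                                   walk? (W ∖ u) (smaller (∖-shorter W u∈W)) x v) (W ∖ u)
  ...     | yes found with Any.satisfied found
  ...       | x , ux , p = yes (step u∈W ux (walk-⊆ ∖-⊆ p))
  walk? W (acc smaller) u v | yes u∈W | no u≢v | no none = no impossible
    where
    impossible : ¬ WalkIn W u v
    impossible p with last-exit p (λ v≡u → u≢v (sym v≡u))
    ... | inj₁ (u≢u , _) = u≢u refl
    ... | inj₂ (x , ux , q) = none (lose (walk-start q) (ux , q))

  connected? : (W : List (Vertex n)) → Dec (Connected W)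
  connected? W = map′ (λ h u∈W v∈W → All.lookup (All.lookup h u∈W) v∈W)
                      (λ c → All.tabulate λ u∈W → All.tabulate λ v∈W → c u∈W v∈W)
    (all? (λ u → all? (λ v → walk? W (<-wellFounded (length W)) u v) W) W)

  dominating? : (W : List (Vertex n)) → Dec (Dominating W)
  dominating? W = map′ (λ h v → All.lookup h (cube-complete v)) (λ d → All.tabulate λ {v} _ → d v)
    (all? (λ v → Any.any? (λ w → (w ≟V v) ⊎-dec adjacent? w v) W) (cube n))

  connDomSet? : (W : List (Vertex n)) → Dec (IsConnDomSet W)
  connDomSet? W = allPairs? (λ x y → ¬? (x ≟V y)) W ×-dec dominating? W ×-dec connected? W

exists-of-length? : ∀ {A : Set} (xs : List A) → (∀ x → x ∈ xs) →
  (P : List A → Set) → (∀ W → Dec (P W)) → ∀ m → Dec (Σ (List A) λ W → P W × length W ≡ m)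
exists-of-length? xs complete P P? zero with P? List.[]
... | yes p = yes (List.[] , p , refl)
... | no ¬p = no λ { (List.[] , p , refl) → ¬p p }
exists-of-length? xs complete P P? (suc m)
  with Any.any? (λ x → exists-of-length? xs complete (λ W → P (x List.∷ W)) (λ W → P? (x List.∷ W)) m) xs
... | yes found with Any.satisfied found
...   | x , W , p , |W|≡m = yes (x List.∷ W , p , cong suc |W|≡m)
exists-of-length? xs complete P P? (suc m) | no none =
  no λ { (x List.∷ W , p , e) → none (lose (complete x) (W , p , suc-injective e)) }

least : ∀ {P : ℕ → Set} → (∀ m → Dec (P m)) → ∀ s → P s → Σ ℕ λ c → P c × (∀ m → P m → c ≤ m)
least {P} P? s Ps = search s Ps (<-wellFounded s)
  where
  search : ∀ s → P s → Acc _<_ s → Σ ℕ λ c → P c × (∀ m → P m → c ≤ m)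
  search s Ps (acc smaller) with anyUpTo? P? s
  ... | yes (m , m<s , Pm) = search m Pm (smaller m<s)
  ... | no none = s , Ps , λ m Pm → ≮⇒≥ (λ m<s → none (m , m<s , Pm))

perfect-code⇒γ : ∀ {n} (S : List (Vertex n)) → Covers S → (n + 1) * length S ≡ 2 ^ n →
  DominationNumber n (length S)
perfect-code⇒γ {n} S cov perfect =
  (S′ , (DecUniqueP.deduplicate-! _≟V_ S , S′-dom) ,
        ≤-antisym (ListP.length-deduplicate _≟V_ S) (minimal S′ S′-dom))
  , λ W (_ , dom) → minimal W dom
  where
  minimal : ∀ W → Dominating W → length S ≤ length W
  minimal W dom = *-cancelˡ-≤ (suc n) (begin
      suc n * length S    ≡⟨ cong (_* length S) (+-comm 1 n) ⟩
      (n + 1) * length S  ≡⟨ perfect ⟩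
      2 ^ n               ≤⟨ sphere-packing W dom ⟩
      suc n * length W    ∎)
    where open ≤-Reasoning
  S′ = deduplicate _≟V_ S
  S′-dom : Dominating S′
  S′-dom = covers⇒dominating (covers-⊆ (∈-deduplicate⁺ _≟V_) cov)

connected-cover⇒γc : ∀ {n} (D : List (Vertex n)) → Covers D → Connected D →
  Σ ℕ λ c → ConnDominationNumber n c × c ≤ length D
connected-cover⇒γc {n} D cov conn =
  c , (Pc , λ W cds → minimal (length W) (W , cds , refl)) ,
  ≤-trans (minimal (length D′) (D′ , D′-cds , refl)) (ListP.length-deduplicate _≟V_ D)
  where
  D′ = deduplicate _≟V_ D
  D′-cds : IsConnDomSet D′
  D′-cds = DecUniqueP.deduplicate-! _≟V_ D
         , covers⇒dominating (covers-⊆ (∈-deduplicate⁺ _≟V_) cov)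
         , λ u∈ v∈ → walk-⊆ (∈-deduplicate⁺ _≟V_)
                       (conn (∈-deduplicate⁻ _≟V_ D u∈) (∈-deduplicate⁻ _≟V_ D v∈))
  minimum = least (exists-of-length? (cube n) cube-complete IsConnDomSet connDomSet?)
                  (length D′) (D′ , D′-cds , refl)
  c = proj₁ minimum
  Pc = proj₁ (proj₂ minimum)
  minimal = proj₂ (proj₂ minimum)

connected-bound : ∀ n {c d e} → c ≤ d → d + 2 ≤ 3 * e → (n + 1) * e ≡ 2 ^ n →
  (n + 1) * c < 3 * 2 ^ n
connected-bound n {c} {d} {e} c≤d d+2≤3e perfect = begin-strict
    (n + 1) * c
  ≤⟨ *-monoʳ-≤ (n + 1) c≤d ⟩
    (n + 1) * d
  <⟨ *-monoʳ-< (n + 1) {{>-nonZero (m≤n+m 1 n)}} (m<m+n d (s≤s z≤n)) ⟩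
    (n + 1) * (d + 2)
  ≤⟨ *-monoʳ-≤ (n + 1) d+2≤3e ⟩
    (n + 1) * (3 * e)
  ≡⟨ solve 2 (λ p e → p :* (con 3 :* e) := con 3 :* (p :* e)) refl (n + 1) e ⟩
    3 * ((n + 1) * e)
  ≡⟨ cong (3 *_) perfect ⟩
    3 * 2 ^ n ∎
  where open ≤-Reasoning

-- Hamming codes: dimensions n_j = 2^(j+1) - 1

dim : ℕ → ℕ
dim zero = 1
dim (suc j) = dim j + (dim j + 1)

-- codim j = dim j - (j + 1), the exponent of the code size.
codim : ℕ → ℕ
codim zero = 0
codim (suc j) = dim j + codim j

dim-closed : ∀ j → dim j + 1 ≡ 2 ^ suc j
dim-closed zero = refl
dim-closed (suc j) = begin
    dim j + (dim j + 1) + 1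
  ≡⟨ solve 1 (λ m → m :+ (m :+ con 1) :+ con 1 := (m :+ con 1) :+ ((m :+ con 1) :+ con 0))
           refl (dim j) ⟩
    (dim j + 1) + ((dim j + 1) + 0)
  ≡⟨ cong (λ t → t + (t + 0)) (dim-closed j) ⟩
    2 ^ suc (suc j) ∎
  where open ≡-Reasoning

dim-split : ∀ j → suc j + codim j ≡ dim j
dim-split zero = refl
dim-split (suc j) = begin
    suc (suc j) + (dim j + codim j)
  ≡⟨ solve 3 (λ s m e → con 1 :+ s :+ (m :+ e) := m :+ ((s :+ e) :+ con 1)) refl (suc j) (dim j) (codim j) ⟩
    dim j + ((suc j + codim j) + 1)
  ≡⟨ cong (λ t → dim j + (t + 1)) (dim-split j) ⟩
    dim j + (dim j + 1) ∎
  where open ≡-Reasoning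

dim-as-power : ∀ j → 2 ^ suc j ∸ 1 ≡ dim j
dim-as-power j = trans (cong (_∸ 1) (sym (dim-closed j))) (m+n∸n≡m (dim j) 1)

codim-as-difference : ∀ j → dim j ∸ suc j ≡ codim j
codim-as-difference j = subst (λ t → t ∸ suc j ≡ codim j) (dim-split j) (m+n∸m≡n (suc j) (codim j))

perfect : ∀ j → (dim j + 1) * 2 ^ codim j ≡ 2 ^ dim j
perfect j = begin
    (dim j + 1) * 2 ^ codim j   ≡⟨ cong (_* 2 ^ codim j) (dim-closed j) ⟩
    2 ^ suc j * 2 ^ codim j     ≡⟨ ^-distribˡ-+-* 2 (suc j) (codim j) ⟨
    2 ^ (suc j + codim j)       ≡⟨ cong (2 ^_) (dim-split j) ⟩
    2 ^ dim j                   ∎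
  where open ≡-Reasoning

origin : List (Vertex 1)
origin = zeros List.∷ List.[]

origin-covers : Covers origin
origin-covers (false ∷ []) = zeros , here refl , z≤n
origin-covers (true ∷ []) = zeros , here refl , s≤s z≤n

origin-connected : Connected origin
origin-connected (here refl) (here refl) = here (here refl)

hammingCode : ∀ j → List (Vertex (dim j))
hammingCode zero = origin
hammingCode (suc j) = double (hammingCode j)

hammingCode-covers : ∀ j → Covers (hammingCode j)
hammingCode-covers zero = origin-covers
hammingCode-covers (suc j) = double-covers (hammingCode j) (hammingCode-covers j)

hammingCode-length : ∀ j → length (hammingCode j) ≡ 2 ^ codim j
hammingCode-length zero = refl
hammingCode-length (suc j) = begin
    length (double (hammingCode j))   ≡⟨ double-length (hammingCode j) ⟩
    2 ^ dim j * length (hammingCode j) ≡⟨ cong (2 ^ dim j *_) (hammingCode-length j) ⟩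
    2 ^ dim j * 2 ^ codim j           ≡⟨ ^-distribˡ-+-* 2 (dim j) (codim j) ⟨
    2 ^ codim (suc j)                 ∎
  where open ≡-Reasoning

connectedCode : ∀ j → List (Vertex (dim j))
connectedCode zero = origin
connectedCode (suc j) = connected-double (connectedCode j)

connectedCode-structure : ∀ j → zeros ∈ connectedCode j × Connected (connectedCode j) × Covers (connectedCode j)
connectedCode-structure zero = here refl , origin-connected , origin-covers
connectedCode-structure (suc j) with connectedCode-structure j
... | 0∈D , D-connected , D-covers =
  ConnectedDouble.contains-zero D 0∈D D-connected ,
  ConnectedDouble.connected D 0∈D D-connected ,
  covers-⊆ ∈-++⁺ˡ (double-covers D D-covers)
  where D = connectedCode j

connectedCode-length : ∀ j → length (connectedCode j) + 2 ≤ 3 * 2 ^ codim j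
connectedCode-length zero = ≤-refl
connectedCode-length (suc j) = begin
    length (connected-double (connectedCode j)) + 2
  ≤⟨ connected-double-length (connectedCode j) ⟩
    2 ^ dim j * (length (connectedCode j) + 2)
  ≤⟨ *-monoʳ-≤ (2 ^ dim j) (connectedCode-length j) ⟩
    2 ^ dim j * (3 * 2 ^ codim j)
  ≡⟨ solve 2 (λ p q → p :* (con 3 :* q) := con 3 :* (p :* q)) refl (2 ^ dim j) (2 ^ codim j) ⟩
    3 * (2 ^ dim j * 2 ^ codim j)
  ≡⟨ cong (3 *_) (^-distribˡ-+-* 2 (dim j) (codim j)) ⟨
    3 * 2 ^ codim (suc j) ∎
  where open ≤-Reasoning

γ-hamming : ∀ j → DominationNumber (dim j) (2 ^ codim j)
γ-hamming j = subst (DominationNumber (dim j)) (hammingCode-length j)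
  (perfect-code⇒γ (hammingCode j) (hammingCode-covers j)
    (trans (cong ((dim j + 1) *_) (hammingCode-length j)) (perfect j)))

γc-hamming : ∀ j → Σ ℕ λ c → ConnDominationNumber (dim j) c × (dim j + 1) * c < 3 * 2 ^ dim j
γc-hamming j with connectedCode-structure j
... | _ , D-connected , D-covers with connected-cover⇒γc (connectedCode j) D-covers D-connected
...   | c , γc , c≤|D| = c , γc , connected-bound (dim j) c≤|D| (connectedCode-length j) (perfect j)

-- Write k = j + 1; then n = dim j and n - k = codim j.
proposition3 : (k : ℕ) → 1 ≤ k → (n : ℕ) → n ≡ 2 ^ k ∸ 1 →
    (DominationNumber n (2 ^ (n ∸ k)) × (n + 1) * 2 ^ (n ∸ k) ≡ 2 ^ n)
    × (Σ ℕ λ c → ConnDominationNumber n c × (n + 1) * c < 3 * 2 ^ n)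
proposition3 (suc j) _ n n≡2^k-1 with trans n≡2^k-1 (dim-as-power j)
... | refl rewrite codim-as-difference j = (γ-hamming j , perfect j) , γc-hamming j
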